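{- $\mathbb{V}_3=V(\mathbf{D}_5)$, i.e. the variety $\mathrm{Mod}(\mathrm{Eq}(\mathbb{AOL})\cup\{x\wedge(y\vee z)\approx(x\wedge y)\vee(x\wedge z),\ (x\wedge y)^{\sim}\approx x^{\sim}\vee y^{\sim}\})$ is generated by $\mathbf{D}_5$.
   Context: A bounded involution lattice is a bounded lattice with an order-reversing involution $'$; it is a pseudo-Kleene algebra if $a\wedge a'\leq b\vee b'$ for all $a,b$. A BZ-lattice is an algebra $\langle B,\wedge,\vee,',^{\sim},0,1\rangle$ whose $^{\sim}$-free reduct is a pseudo-Kleene algebra and which satisfies: $a\wedge a^{\sim}=0$; $a\leq a^{\sim\sim}$; $a\leq b$ implies $b^{\sim}\leq a^{\sim}$; $a^{\sim\prime}=a^{\sim\sim}$. Write $\Diamond x=x^{\sim\sim}$. A PBZ*-lattice is a BZ-lattice satisfying $(a\wedge a')^{\sim}\leq a^{\sim}\vee a'^{\sim}$ and $(a^{\sim}\vee(\Diamond a\wedge\Diamond b))\wedge\Diamond a\leq\Diamond b$. An antiortholattice is a PBZ*-lattice whose only elements $a$ with $a\wedge a'=0$ are $0$ and $1$; $\mathrm{Eq}(\mathbb{AOL})$ is the set of identities valid in all antiortholattices. $\mathbf{D}_5$ is the $5$-element chain $0<a<d<a'<1$ with the unique order-reversing involution $'$ (so $d=d'$) and with $x^{\sim}=0$ for $x>0$, $0^{\sim}=1$. -}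

module Defs where

open import Data.Nat using (ℕ; _≤ᵇ_)
open import Data.Bool using (if_then_else_)
open import Data.Product using (_×_; _,_)
open import Data.Sum using (_⊎_)
open import Relation.Binary.PropositionalEquality using (_≡_)

infixr 7 _∧_
infixr 6 _∨_

record Alg : Set₁ where
  field
    Carrier : Set
    meet join : Carrier → Carrier → Carrier
    inv tilde : Carrier → Carrier
    bot top : Carrier

module _ (A : Alg) where
  open Alg A

  _≤A_ : Carrier → Carrier → Set
  a ≤A b = meet a b ≡ a

  ◇ : Carrier → Carrier
  ◇ a = tilde (tilde a)

  record IsBoundedLattice : Set where
    field
      ∧-assoc : ∀ a b c → meet (meet a b) c ≡ meet a (meet b c)
      ∨-assoc : ∀ a b c → join (join a b) c ≡ join a (join b c)
      ∧-comm  : ∀ a b → meet a b ≡ meet b a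
      ∨-comm  : ∀ a b → join a b ≡ join b a
      ∧-absorb : ∀ a b → meet a (join a b) ≡ a
      ∨-absorb : ∀ a b → join a (meet a b) ≡ a
      bot-least : ∀ a → bot ≤A a
      top-greatest : ∀ a → a ≤A top

  record IsBoundedInvolutionLattice : Set where
    field
      isBoundedLattice : IsBoundedLattice
      involutive : ∀ a → inv (inv a) ≡ a
      order-reversing : ∀ a b → a ≤A b → inv b ≤A inv a

  record IsPseudoKleene : Set where
    field
      isBIL : IsBoundedInvolutionLattice
      kleene : ∀ a b → meet a (inv a) ≤A join b (inv b)

  record IsBZLattice : Set where
    field
      isPseudoKleene : IsPseudoKleene
      bz1 : ∀ a → meet a (tilde a) ≡ bot
      bz2 : ∀ a → a ≤A tilde (tilde a)
      bz3 : ∀ a b → a ≤A b → tilde b ≤A tilde a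
      bz4 : ∀ a → inv (tilde a) ≡ tilde (tilde a)

  record IsPBZ* : Set where
    field
      isBZ : IsBZLattice
      star : ∀ a → tilde (meet a (inv a)) ≤A join (tilde a) (tilde (inv a))
      pbz : ∀ a b → meet (join (tilde a) (meet (◇ a) (◇ b))) (◇ a) ≤A ◇ b

  record IsAntiortholattice : Set where
    field
      isPBZ* : IsPBZ*
      anti : ∀ a → meet a (inv a) ≡ bot → (a ≡ bot) ⊎ (a ≡ top)

data Term : Set where
  var : ℕ → Term
  _∧_ _∨_ : Term → Term → Term
  _′ _~ : Term → Term
  𝟎 𝟏 : Term

eval : (A : Alg) → (ℕ → Alg.Carrier A) → Term → Alg.Carrier A
eval A ρ (var n) = ρ n
eval A ρ (s ∧ t) = Alg.meet A (eval A ρ s) (eval A ρ t)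
eval A ρ (s ∨ t) = Alg.join A (eval A ρ s) (eval A ρ t)
eval A ρ (s ′) = Alg.inv A (eval A ρ s)
eval A ρ (s ~) = Alg.tilde A (eval A ρ s)
eval A ρ 𝟎 = Alg.bot A
eval A ρ 𝟏 = Alg.top A

Identity : Set
Identity = Term × Term

_⊨_ : Alg → Identity → Set
A ⊨ (s , t) = ∀ (ρ : ℕ → Alg.Carrier A) → eval A ρ s ≡ eval A ρ t

EqAOL : Identity → Set₁
EqAOL e = ∀ (B : Alg) → IsAntiortholattice B → B ⊨ e

x y z : Term
x = var 0
y = var 1
z = var 2

distributivity : Identity
distributivity = (x ∧ (y ∨ z) , (x ∧ y) ∨ (x ∧ z))

strongDeMorgan : Identity
strongDeMorgan = ((x ∧ y) ~ , (x ~) ∨ (y ~))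

InV₃ : Alg → Set₁
InV₃ A = (∀ e → EqAOL e → A ⊨ e) × (A ⊨ distributivity) × (A ⊨ strongDeMorgan)

-- The 5-element chain D₅ : 0 < a < d < a' < 1
data D5 : Set where
  d0 da dd da' d1 : D5

rank : D5 → ℕ
rank d0 = 0
rank da = 1
rank dd = 2
rank da' = 3
rank d1 = 4

D5-inv : D5 → D5
D5-inv d0 = d1
D5-inv da = da'
D5-inv dd = dd
D5-inv da' = da
D5-inv d1 = d0

D5-tilde : D5 → D5
D5-tilde d0 = d1
D5-tilde _ = d0

𝐃₅ : Alg
𝐃₅ = record
  { Carrier = D5
  ; meet = λ a b → if rank a ≤ᵇ rank b then a else b
  ; join = λ a b → if rank a ≤ᵇ rank b then b else a
  ; inv = D5-inv
  ; tilde = D5-tilde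
  ; bot = d0
  ; top = d1
  }

-- A ∈ V(D₅), via Birkhoff's HSP theorem: V(D₅) = Mod(Eq(D₅))
InVD5 : Alg → Set
InVD5 A = ∀ e → 𝐃₅ ⊨ e → A ⊨ e

-- V(𝐃₅) ⊆ 𝕍₃ since 𝐃₅ is a distributive antiortholattice with the strong De Morgan law.
-- For 𝕍₃ ⊆ V(𝐃₅), let A ∈ 𝕍₃ and s ≈ t hold in 𝐃₅.  The laws of 𝕍₃ push ′ and ~ down
-- to the variables, so every term equals a DNF and a CNF over the literals x, x′, x~,
-- x′~, x~~, x′~~ (NormalForms), and s ≤ t reduces to ⋀C ≤ ⋁D for the clauses C of the
-- DNF of s and D of the CNF of t; these hold in 𝐃₅.  The clause lemma lifts them to every
-- antiortholattice B: each element of B is 0, 1 or middle (a~ = a′~ = 0; AOLFacts), so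
-- literals evaluate to 0, 1, x or x′.  Either an easy reason (a 0 in C, a 1 in D, a
-- shared literal, or pairs x, x′ on both sides) gives ⋀C ≤ ⋁D, or a valuation of 𝐃₅ of
-- the same shape separates ⋀C from ⋁D.  As an identity of 𝔸𝕆𝕃, ⋀C ≤ ⋁D holds in A.
module Submission where

open import Defs
open import Data.Bool using (Bool; true; false; not; T)
open import Data.Bool.Properties using (not-involutive) renaming (_≟_ to _≟Bool_)
open import Data.Empty using (⊥; ⊥-elim)
open import Data.Fin using (Fin; zero; suc)
import Data.Fin.Properties as Fin
open import Data.List using (List; []; _∷_; _++_; map)
open import Data.List.Membership.Propositional using (_∈_; _∉_; find; lose)
open import Data.List.Relation.Unary.Any using (Any; here; there; any?)
open import Data.Nat using (ℕ; _≤_; _<_; _≤ᵇ_; z≤n; s≤s) renaming (_≟_ to _≟ℕ_)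
open import Data.Nat.Properties using (≤ᵇ⇒≤; ≤-refl; <-≤-trans; n≮n)
open import Data.Product using (_×_; _,_; proj₁; ∃-syntax)
open import Data.Product.Properties using (≡-dec)
open import Data.Sum using (_⊎_; inj₁; inj₂)
open import Data.Unit using (tt)
open import Function using (_∘_)
open import Function.Bundles using (_⇔_; mk⇔)
open import Relation.Binary.Definitions using (DecidableEquality)
open import Relation.Binary.PropositionalEquality
open import Relation.Nullary using (¬_; Dec; yes; no)
open import Relation.Nullary.Decidable using (map′; from-yes; _×-dec_; _⊎-dec_; _→-dec_)

module LatticeOrder (A : Alg) (lat : IsBoundedLattice A) where
  open Alg A
  open IsBoundedLattice lat public

  _⊑_ : Carrier → Carrier → Set
  a ⊑ b = _≤A_ A a b

  ∧-idem : ∀ a → meet a a ≡ a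
  ∧-idem a = trans (cong (meet a) (sym (∨-absorb a a))) (∧-absorb a (meet a a))

  ⊑-refl : ∀ {a} → a ⊑ a
  ⊑-refl {a} = ∧-idem a

  ⊑-trans : ∀ {a b c} → a ⊑ b → b ⊑ c → a ⊑ c
  ⊑-trans {a} {b} {c} a⊑b b⊑c = begin
    meet a c          ≡⟨ cong (λ u → meet u c) (sym a⊑b) ⟩
    meet (meet a b) c ≡⟨ ∧-assoc a b c ⟩
    meet a (meet b c) ≡⟨ cong (meet a) b⊑c ⟩
    meet a b          ≡⟨ a⊑b ⟩
    a                 ∎
    where open ≡-Reasoning

  ⊑-antisym : ∀ {a b} → a ⊑ b → b ⊑ a → a ≡ b
  ⊑-antisym {a} {b} a⊑b b⊑a = trans (sym a⊑b) (trans (∧-comm a b) b⊑a)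

  ≡⇒⊑ : ∀ {a b} → a ≡ b → a ⊑ b
  ≡⇒⊑ refl = ⊑-refl

  ⊑⇒join : ∀ {a b} → a ⊑ b → join a b ≡ b
  ⊑⇒join {a} {b} a⊑b = begin
    join a b          ≡⟨ cong (λ u → join u b) (sym a⊑b) ⟩
    join (meet a b) b ≡⟨ ∨-comm (meet a b) b ⟩
    join b (meet a b) ≡⟨ cong (join b) (∧-comm a b) ⟩
    join b (meet b a) ≡⟨ ∨-absorb b a ⟩
    b                 ∎
    where open ≡-Reasoning

  join⇒⊑ : ∀ {a b} → join a b ≡ b → a ⊑ b
  join⇒⊑ {a} {b} e = trans (cong (meet a) (sym e)) (∧-absorb a b)

  ∧-lb₁ : ∀ a b → meet a b ⊑ a
  ∧-lb₁ a b = trans (∧-comm (meet a b) a)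
    (trans (sym (∧-assoc a a b)) (cong (λ u → meet u b) (∧-idem a)))

  ∧-lb₂ : ∀ a b → meet a b ⊑ b
  ∧-lb₂ a b = trans (∧-assoc a b b) (cong (meet a) (∧-idem b))

  glb : ∀ {a b c} → c ⊑ a → c ⊑ b → c ⊑ meet a b
  glb {a} {b} {c} c⊑a c⊑b = trans (sym (∧-assoc c a b)) (trans (cong (λ u → meet u b) c⊑a) c⊑b)

  ∨-ub₁ : ∀ a b → a ⊑ join a b
  ∨-ub₁ = ∧-absorb

  ∨-ub₂ : ∀ a b → b ⊑ join a b
  ∨-ub₂ a b = trans (cong (meet b) (∨-comm a b)) (∧-absorb b a)

  lub : ∀ {a b c} → a ⊑ c → b ⊑ c → join a b ⊑ c
  lub {a} {b} {c} a⊑c b⊑c =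
    join⇒⊑ (trans (∨-assoc a b c) (trans (cong (join a) (⊑⇒join b⊑c)) (⊑⇒join a⊑c)))

  top-meet : ∀ a → meet top a ≡ a
  top-meet a = trans (∧-comm top a) (top-greatest a)

  meet-bot : ∀ a → meet a bot ≡ bot
  meet-bot a = trans (∧-comm a bot) (bot-least a)

  bot-join : ∀ a → join bot a ≡ a
  bot-join a = ⊑⇒join (bot-least a)

  join-bot : ∀ a → join a bot ≡ a
  join-bot a = trans (∨-comm a bot) (bot-join a)

  top-join : ∀ a → join top a ≡ top
  top-join a = trans (∨-comm top a) (⊑⇒join (top-greatest a))

  join-top : ∀ a → join a top ≡ top
  join-top a = ⊑⇒join (top-greatest a)

  top⊑ : ∀ {a} → top ⊑ a → a ≡ top
  top⊑ = ⊑-antisym (top-greatest _)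

-- Facts valid in every BZ-lattice: ′ and ~ are antitone Galois connections, hence
-- turn joins into meets, and ~ satisfies ~~~ = ~ and exchanges 0 and 1.
module BZFacts (B : Alg) (bz : IsBZLattice B) where
  open Alg B
  open IsBZLattice bz public using (bz1; bz2; bz3; bz4; isPseudoKleene)
  open IsPseudoKleene isPseudoKleene public using (kleene; isBIL)
  open IsBoundedInvolutionLattice isBIL public using (involutive; order-reversing; isBoundedLattice)
  open LatticeOrder B isBoundedLattice public

  inv-flip : ∀ {a b} → b ⊑ inv a → a ⊑ inv b
  inv-flip {a} {b} b⊑a′ = subst (λ u → u ⊑ inv b) (involutive a) (order-reversing b (inv a) b⊑a′)

  inv-join : ∀ a b → inv (join a b) ≡ meet (inv a) (inv b)
  inv-join a b = ⊑-antisym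
    (glb (order-reversing _ _ (∨-ub₁ a b)) (order-reversing _ _ (∨-ub₂ a b)))
    (inv-flip (lub (inv-flip (∧-lb₁ (inv a) (inv b))) (inv-flip (∧-lb₂ (inv a) (inv b)))))

  inv-bot : inv bot ≡ top
  inv-bot = top⊑ (inv-flip (bot-least (inv top)))

  inv-top : inv top ≡ bot
  inv-top = trans (cong inv (sym inv-bot)) (involutive bot)

  tilde-top : tilde top ≡ bot
  tilde-top = trans (sym (top-meet (tilde top))) (bz1 top)

  tilde-bot : tilde bot ≡ top
  tilde-bot = top⊑ (subst (λ u → top ⊑ tilde u) tilde-top (bz2 top))

  -- ~ is its own Galois adjoint, since a ≤ a~~
  tilde-galois : ∀ {a b} → a ⊑ tilde b → b ⊑ tilde a
  tilde-galois {a} {b} a⊑b~ = ⊑-trans (bz2 b) (bz3 a (tilde b) a⊑b~)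

  tilde-join : ∀ a b → tilde (join a b) ≡ meet (tilde a) (tilde b)
  tilde-join a b = ⊑-antisym
    (glb (bz3 _ _ (∨-ub₁ a b)) (bz3 _ _ (∨-ub₂ a b)))
    (tilde-galois (lub (tilde-galois (∧-lb₁ (tilde a) (tilde b)))
                       (tilde-galois (∧-lb₂ (tilde a) (tilde b)))))

  tilde³ : ∀ a → tilde (tilde (tilde a)) ≡ tilde a
  tilde³ a = ⊑-antisym (bz3 _ _ (bz2 a)) (bz2 (tilde a))

-- Literals are the terms x, x′, x~, x′~, x~~ and x′~~: a sign applied to a variable,
-- followed by zero, one or two tildes.
data Sign : Set where
  pos neg : Sign

data Tildes : Set where
  none once twice : Tildes

Lit : Set
Lit = ℕ × Sign × Tildes

signedT : Sign → Term → Term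
signedT pos u = u
signedT neg u = u ′

tildesT : Tildes → Term → Term
tildesT none u = u
tildesT once u = u ~
tildesT twice u = u ~ ~

litT : Lit → Term
litT (n , s , t) = tildesT t (signedT s (var n))

module _ (A : Alg) where
  open Alg A

  signed : Sign → Carrier → Carrier
  signed pos a = a
  signed neg a = inv a

  tildes : Tildes → Carrier → Carrier
  tildes none a = a
  tildes once a = tilde a
  tildes twice a = tilde (tilde a)

  const : Bool → Carrier
  const false = bot
  const true = top

  evalLit : ∀ ρ n s t → eval A ρ (litT (n , s , t)) ≡ tildes t (signed s (ρ n))
  evalLit ρ n pos none = refl
  evalLit ρ n neg none = refl
  evalLit ρ n pos once = refl
  evalLit ρ n neg once = refl
  evalLit ρ n pos twice = refl
  evalLit ρ n neg twice = refl

-- On the constants 0 and 1, both ′ and ~ act as Boolean negation.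
signB : Sign → Bool → Bool
signB pos b = b
signB neg b = not b

tildesB : Tildes → Bool → Bool
tildesB none b = b
tildesB once b = not b
tildesB twice b = b

data Shape : Set where
  isConst : Bool → Shape
  isMiddle : Shape

-- The symbolic value of a literal: a constant, or the variable itself, possibly negated.
data Val : Set where
  constV : Bool → Val
  signedV : Sign → Val

interp : (A : Alg) → Alg.Carrier A → Val → Alg.Carrier A
interp A a (constV b) = const A b
interp A a (signedV s) = signed A s a

-- Value of the literal with sign s and t tildes on a variable of the given shape:
-- on a middle element a we have a~ = a′~ = 0, so one tilde gives 0 and two give 1.
litVal : Shape → Sign → Tildes → Val
litVal (isConst b) s t = constV (tildesB t (signB s b))
litVal isMiddle s none = signedV s
litVal isMiddle s once = constV false
litVal isMiddle s twice = constV true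

litVal-signed : ∀ {sh s t s′} → litVal sh s t ≡ signedV s′ → sh ≡ isMiddle × t ≡ none × s ≡ s′
litVal-signed {isConst _} ()
litVal-signed {isMiddle} {t = none} refl = refl , refl , refl
litVal-signed {isMiddle} {t = once} ()
litVal-signed {isMiddle} {t = twice} ()

module AOLFacts (B : Alg) (aol : IsAntiortholattice B) where
  open Alg B
  open IsAntiortholattice aol using (anti; isPBZ*)
  open BZFacts B (IsPBZ*.isBZ isPBZ*) public

  data Class (a : Carrier) : Set where
    constant : (b : Bool) → a ≡ const B b → Class a
    middle : tilde a ≡ bot → tilde (inv a) ≡ bot → Class a

  shape : ∀ {a} → Class a → Shape
  shape (constant b _) = isConst b
  shape (middle _ _) = isMiddle

  -- a~ ∧ (a~)′ = a~ ∧ a~~ = 0, so by the antiortholattice axiom a~ is 0 or 1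
  tilde-sharp : ∀ a → meet (tilde a) (inv (tilde a)) ≡ bot
  tilde-sharp a = trans (cong (meet (tilde a)) (bz4 a)) (bz1 (tilde a))

  -- a~ = 1 forces a = a ∧ a~ = 0
  tilde≡top : ∀ {a} → tilde a ≡ top → a ≡ bot
  tilde≡top {a} a~≡1 = trans (sym (top-greatest a)) (trans (cong (meet a) (sym a~≡1)) (bz1 a))

  classify : ∀ a → Class a
  classify a with anti (tilde a) (tilde-sharp a)
  ... | inj₂ a~≡1 = constant false (tilde≡top a~≡1)
  ... | inj₁ a~≡0 with anti (tilde (inv a)) (tilde-sharp (inv a))
  ...   | inj₁ a′~≡0 = middle a~≡0 a′~≡0
  ...   | inj₂ a′~≡1 = constant true
          (trans (sym (involutive a)) (trans (cong inv (tilde≡top a′~≡1)) inv-bot))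

  inv-const : ∀ b → inv (const B b) ≡ const B (not b)
  inv-const false = inv-bot
  inv-const true = inv-top

  tilde-const : ∀ b → tilde (const B b) ≡ const B (not b)
  tilde-const false = tilde-bot
  tilde-const true = tilde-top

  signed-const : ∀ s b → signed B s (const B b) ≡ const B (signB s b)
  signed-const pos b = refl
  signed-const neg b = inv-const b

  tildes-const : ∀ t b → tildes B t (const B b) ≡ const B (tildesB t b)
  tildes-const none b = refl
  tildes-const once b = tilde-const b
  tildes-const twice b = trans (cong tilde (tilde-const b))
    (trans (tilde-const (not b)) (cong (const B) (not-involutive b)))

  literal-value : ∀ {a} (c : Class a) s t → tildes B t (signed B s a) ≡ interp B a (litVal (shape c) s t)
  literal-value (constant b refl) s t = trans (cong (tildes B t) (signed-const s b)) (tildes-const t _)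
  literal-value (middle a~ a′~) s none = refl
  literal-value (middle a~ a′~) pos once = a~
  literal-value (middle a~ a′~) neg once = a′~
  literal-value (middle a~ a′~) pos twice = trans (cong tilde a~) tilde-bot
  literal-value (middle a~ a′~) neg twice = trans (cong tilde a′~) tilde-bot

record NormalFormLaws (A : Alg) : Set where
  open Alg A
  field
    lattice : IsBoundedLattice A
    distrib : ∀ a b c → meet a (join b c) ≡ join (meet a b) (meet a c)
    inv-invol : ∀ a → inv (inv a) ≡ a
    inv-join : ∀ a b → inv (join a b) ≡ meet (inv a) (inv b)
    inv-bot : inv bot ≡ top
    tilde-join : ∀ a b → tilde (join a b) ≡ meet (tilde a) (tilde b)
    tilde-meet : ∀ a b → tilde (meet a b) ≡ join (tilde a) (tilde b)
    tilde-bot : tilde bot ≡ top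
    tilde-top : tilde top ≡ bot
    tilde³ : ∀ a → tilde (tilde (tilde a)) ≡ tilde a
    inv-tilde : ∀ a → inv (tilde a) ≡ tilde (tilde a)

env : {X : Set} → X → X → X → ℕ → X
env a b c 0 = a
env a b c 1 = b
env a b c _ = c

-- Every member of 𝕍₃ satisfies the normal form laws: all but distributivity and the
-- strong De Morgan law hold in every antiortholattice.
normalFormLaws : (A : Alg) → InV₃ A → NormalFormLaws A
normalFormLaws A (aolIdentities , distributive , strongDM) = record
  { lattice = record
    { ∧-assoc = λ a b c → byAOL ((x ∧ y) ∧ z) (x ∧ (y ∧ z))
                  (λ B aol ρ → AOLFacts.∧-assoc B aol (ρ 0) (ρ 1) (ρ 2)) (env a b c)
    ; ∨-assoc = λ a b c → byAOL ((x ∨ y) ∨ z) (x ∨ (y ∨ z))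
                  (λ B aol ρ → AOLFacts.∨-assoc B aol (ρ 0) (ρ 1) (ρ 2)) (env a b c)
    ; ∧-comm = λ a b → byAOL (x ∧ y) (y ∧ x) (λ B aol ρ → AOLFacts.∧-comm B aol (ρ 0) (ρ 1)) (env a b b)
    ; ∨-comm = λ a b → byAOL (x ∨ y) (y ∨ x) (λ B aol ρ → AOLFacts.∨-comm B aol (ρ 0) (ρ 1)) (env a b b)
    ; ∧-absorb = λ a b → byAOL (x ∧ (x ∨ y)) x
                   (λ B aol ρ → AOLFacts.∧-absorb B aol (ρ 0) (ρ 1)) (env a b b)
    ; ∨-absorb = λ a b → byAOL (x ∨ (x ∧ y)) x
                   (λ B aol ρ → AOLFacts.∨-absorb B aol (ρ 0) (ρ 1)) (env a b b)
    ; bot-least = λ a → byAOL (𝟎 ∧ x) 𝟎 (λ B aol ρ → AOLFacts.bot-least B aol (ρ 0)) (env a a a)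
    ; top-greatest = λ a → byAOL (x ∧ 𝟏) x (λ B aol ρ → AOLFacts.top-greatest B aol (ρ 0)) (env a a a)
    }
  ; distrib = λ a b c → distributive (env a b c)
  ; inv-invol = λ a → byAOL (x ′ ′) x (λ B aol ρ → AOLFacts.involutive B aol (ρ 0)) (env a a a)
  ; inv-join = λ a b → byAOL ((x ∨ y) ′) ((x ′) ∧ (y ′))
                 (λ B aol ρ → AOLFacts.inv-join B aol (ρ 0) (ρ 1)) (env a b b)
  ; inv-bot = byAOL (𝟎 ′) 𝟏 (λ B aol ρ → AOLFacts.inv-bot B aol) (λ _ → bot)
  ; tilde-join = λ a b → byAOL ((x ∨ y) ~) ((x ~) ∧ (y ~))
                   (λ B aol ρ → AOLFacts.tilde-join B aol (ρ 0) (ρ 1)) (env a b b)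
  ; tilde-meet = λ a b → strongDM (env a b b)
  ; tilde-bot = byAOL (𝟎 ~) 𝟏 (λ B aol ρ → AOLFacts.tilde-bot B aol) (λ _ → bot)
  ; tilde-top = byAOL (𝟏 ~) 𝟎 (λ B aol ρ → AOLFacts.tilde-top B aol) (λ _ → bot)
  ; tilde³ = λ a → byAOL (x ~ ~ ~) (x ~) (λ B aol ρ → AOLFacts.tilde³ B aol (ρ 0)) (env a a a)
  ; inv-tilde = λ a → byAOL (x ~ ′) (x ~ ~) (λ B aol ρ → AOLFacts.bz4 B aol (ρ 0)) (env a a a)
  }
  where
  open Alg A
  byAOL : ∀ s t → (∀ B → IsAntiortholattice B → B ⊨ (s , t)) → A ⊨ (s , t)
  byAOL s t valid = aolIdentities (s , t) valid

Clause : Set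
Clause = List Lit

conj disj : Clause → Term
conj [] = 𝟏
conj (l ∷ C) = litT l ∧ conj C
disj [] = 𝟎
disj (l ∷ C) = litT l ∨ disj C

dnfTerm cnfTerm : List Clause → Term
dnfTerm [] = 𝟎
dnfTerm (C ∷ F) = conj C ∨ dnfTerm F
cnfTerm [] = 𝟏
cnfTerm (C ∷ F) = disj C ∧ cnfTerm F

-- The literal equal to the negation, resp. the tilde, of a literal (x~′ = x~~, x~~′ = x~,
-- x~~~ = x~).
negL tildeL : Lit → Lit
negL (n , s , once) = (n , s , twice)
negL (n , s , twice) = (n , s , once)
negL (n , pos , none) = (n , neg , none)
negL (n , neg , none) = (n , pos , none)
tildeL (n , s , none) = (n , s , once)
tildeL (n , s , once) = (n , s , twice)
tildeL (n , s , twice) = (n , s , once)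

cross : List Clause → List Clause → List Clause
cross [] G = []
cross (C ∷ F) G = map (C ++_) G ++ cross F G

-- ′ and ~ swap DNF and CNF (De Morgan), so both are computed by simultaneous recursion.
dnf cnf : Term → List Clause
dnf (var n) = ((n , pos , none) ∷ []) ∷ []
dnf (s ∧ t) = cross (dnf s) (dnf t)
dnf (s ∨ t) = dnf s ++ dnf t
dnf (s ′) = map (map negL) (cnf s)
dnf (s ~) = map (map tildeL) (cnf s)
dnf 𝟎 = []
dnf 𝟏 = [] ∷ []
cnf (var n) = ((n , pos , none) ∷ []) ∷ []
cnf (s ∧ t) = cnf s ++ cnf t
cnf (s ∨ t) = cross (cnf s) (cnf t)
cnf (s ′) = map (map negL) (dnf s)
cnf (s ~) = map (map tildeL) (dnf s)
cnf 𝟎 = [] ∷ []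
cnf 𝟏 = []

module ClauseOrder (A : Alg) (lat : IsBoundedLattice A) (ρ : ℕ → Alg.Carrier A) where
  open Alg A
  open LatticeOrder A lat

  ⟦_⟧ : Term → Carrier
  ⟦ t ⟧ = eval A ρ t

  conj-lower : ∀ {l C} → l ∈ C → ⟦ conj C ⟧ ⊑ ⟦ litT l ⟧
  conj-lower (here refl) = ∧-lb₁ _ _
  conj-lower (there l∈C) = ⊑-trans (∧-lb₂ _ _) (conj-lower l∈C)

  disj-upper : ∀ {l C} → l ∈ C → ⟦ litT l ⟧ ⊑ ⟦ disj C ⟧
  disj-upper (here refl) = ∨-ub₁ _ _
  disj-upper (there l∈C) = ⊑-trans (disj-upper l∈C) (∨-ub₂ _ _)

  conj-below-dnf : ∀ {C F} → C ∈ F → ⟦ conj C ⟧ ⊑ ⟦ dnfTerm F ⟧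
  conj-below-dnf (here refl) = ∨-ub₁ _ _
  conj-below-dnf (there C∈F) = ⊑-trans (conj-below-dnf C∈F) (∨-ub₂ _ _)

  cnf-below-disj : ∀ {D G} → D ∈ G → ⟦ cnfTerm G ⟧ ⊑ ⟦ disj D ⟧
  cnf-below-disj (here refl) = ∧-lb₁ _ _
  cnf-below-disj (there D∈G) = ⊑-trans (∧-lb₂ _ _) (cnf-below-disj D∈G)

  dnf-below-cnf : ∀ F G → (∀ {C D} → C ∈ F → D ∈ G → ⟦ conj C ⟧ ⊑ ⟦ disj D ⟧)
                → ⟦ dnfTerm F ⟧ ⊑ ⟦ cnfTerm G ⟧
  dnf-below-cnf [] G _ = bot-least _
  dnf-below-cnf (C ∷ F) G below = lub (below-cnf G (λ D∈G → below (here refl) D∈G))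
                                      (dnf-below-cnf F G (λ C∈F → below (there C∈F)))
    where
    below-cnf : ∀ G → (∀ {D} → D ∈ G → ⟦ conj C ⟧ ⊑ ⟦ disj D ⟧) → ⟦ conj C ⟧ ⊑ ⟦ cnfTerm G ⟧
    below-cnf [] _ = top-greatest _
    below-cnf (D ∷ G) h = glb (h (here refl)) (below-cnf G (λ D∈G → h (there D∈G)))

module NormalForms (A : Alg) (L : NormalFormLaws A) (ρ : ℕ → Alg.Carrier A) where
  open Alg A
  open NormalFormLaws L
  open LatticeOrder A lattice
  open ClauseOrder A lattice ρ using (conj-below-dnf; cnf-below-disj; dnf-below-cnf)

  ⟦_⟧ : Term → Carrier
  ⟦ t ⟧ = eval A ρ t

  inv-meet : ∀ a b → inv (meet a b) ≡ join (inv a) (inv b)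
  inv-meet a b = begin
    inv (meet a b)
      ≡⟨ cong₂ (λ u v → inv (meet u v)) (sym (inv-invol a)) (sym (inv-invol b)) ⟩
    inv (meet (inv (inv a)) (inv (inv b)))
      ≡⟨ cong inv (sym (inv-join (inv a) (inv b))) ⟩
    inv (inv (join (inv a) (inv b)))
      ≡⟨ inv-invol _ ⟩
    join (inv a) (inv b) ∎
    where open ≡-Reasoning

  inv-top : inv top ≡ bot
  inv-top = trans (cong inv (sym inv-bot)) (inv-invol bot)

  -- the dual distributive law, obtained by applying ′ to distributivity
  distrib-dual : ∀ a b c → join a (meet b c) ≡ meet (join a b) (join a c)
  distrib-dual a b c = begin
    join a (meet b c)
      ≡⟨ sym (inv-invol _) ⟩
    inv (inv (join a (meet b c)))
      ≡⟨ cong inv (trans (inv-join a _) (cong (meet (inv a)) (inv-meet b c))) ⟩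
    inv (meet (inv a) (join (inv b) (inv c)))
      ≡⟨ cong inv (distrib (inv a) (inv b) (inv c)) ⟩
    inv (join (meet (inv a) (inv b)) (meet (inv a) (inv c)))
      ≡⟨ cong inv (cong₂ join (sym (inv-join a b)) (sym (inv-join a c))) ⟩
    inv (join (inv (join a b)) (inv (join a c)))
      ≡⟨ trans (inv-join _ _) (cong₂ meet (inv-invol _) (inv-invol _)) ⟩
    meet (join a b) (join a c) ∎
    where open ≡-Reasoning

  distribʳ : ∀ a b c → meet (join a b) c ≡ join (meet a c) (meet b c)
  distribʳ a b c = trans (∧-comm _ c) (trans (distrib c a b) (cong₂ join (∧-comm c a) (∧-comm c b)))

  distrib-dualʳ : ∀ a b c → join (meet a b) c ≡ meet (join a c) (join b c)
  distrib-dualʳ a b c = trans (∨-comm _ c) (trans (distrib-dual c a b) (cong₂ meet (∨-comm c a) (∨-comm c b)))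

  negL-correct : ∀ l → ⟦ litT (negL l) ⟧ ≡ inv ⟦ litT l ⟧
  negL-correct (n , pos , none) = refl
  negL-correct (n , neg , none) = sym (inv-invol _)
  negL-correct (n , s , once) = sym (inv-tilde _)
  negL-correct (n , s , twice) = sym (trans (inv-tilde _) (tilde³ _))

  tildeL-correct : ∀ l → ⟦ litT (tildeL l) ⟧ ≡ tilde ⟦ litT l ⟧
  tildeL-correct (n , s , none) = refl
  tildeL-correct (n , s , once) = refl
  tildeL-correct (n , s , twice) = sym (tilde³ _)

  conj-++ : ∀ C C′ → ⟦ conj (C ++ C′) ⟧ ≡ meet ⟦ conj C ⟧ ⟦ conj C′ ⟧
  conj-++ [] C′ = sym (top-meet _)
  conj-++ (l ∷ C) C′ = trans (cong (meet _) (conj-++ C C′)) (sym (∧-assoc _ _ _))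

  disj-++ : ∀ C C′ → ⟦ disj (C ++ C′) ⟧ ≡ join ⟦ disj C ⟧ ⟦ disj C′ ⟧
  disj-++ [] C′ = sym (bot-join _)
  disj-++ (l ∷ C) C′ = trans (cong (join _) (disj-++ C C′)) (sym (∨-assoc _ _ _))

  dnf-++ : ∀ F G → ⟦ dnfTerm (F ++ G) ⟧ ≡ join ⟦ dnfTerm F ⟧ ⟦ dnfTerm G ⟧
  dnf-++ [] G = sym (bot-join _)
  dnf-++ (C ∷ F) G = trans (cong (join _) (dnf-++ F G)) (sym (∨-assoc _ _ _))

  cnf-++ : ∀ F G → ⟦ cnfTerm (F ++ G) ⟧ ≡ meet ⟦ cnfTerm F ⟧ ⟦ cnfTerm G ⟧
  cnf-++ [] G = sym (top-meet _)
  cnf-++ (C ∷ F) G = trans (cong (meet _) (cnf-++ F G)) (sym (∧-assoc _ _ _))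

  dnf-cross : ∀ F G → ⟦ dnfTerm (cross F G) ⟧ ≡ meet ⟦ dnfTerm F ⟧ ⟦ dnfTerm G ⟧
  dnf-cross [] G = sym (bot-least _)
  dnf-cross (C ∷ F) G = trans (dnf-++ (map (C ++_) G) (cross F G))
    (trans (cong₂ join (prefix G) (dnf-cross F G)) (sym (distribʳ _ _ _)))
    where
    prefix : ∀ G → ⟦ dnfTerm (map (C ++_) G) ⟧ ≡ meet ⟦ conj C ⟧ ⟦ dnfTerm G ⟧
    prefix [] = sym (meet-bot _)
    prefix (C′ ∷ G) = trans (cong₂ join (conj-++ C C′) (prefix G)) (sym (distrib _ _ _))

  cnf-cross : ∀ F G → ⟦ cnfTerm (cross F G) ⟧ ≡ join ⟦ cnfTerm F ⟧ ⟦ cnfTerm G ⟧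
  cnf-cross [] G = sym (top-join _)
  cnf-cross (C ∷ F) G = trans (cnf-++ (map (C ++_) G) (cross F G))
    (trans (cong₂ meet (prefix G) (cnf-cross F G)) (sym (distrib-dualʳ _ _ _)))
    where
    prefix : ∀ G → ⟦ cnfTerm (map (C ++_) G) ⟧ ≡ join ⟦ disj C ⟧ ⟦ cnfTerm G ⟧
    prefix [] = sym (join-top _)
    prefix (C′ ∷ G) = trans (cong₂ meet (disj-++ C C′) (prefix G)) (sym (distrib-dual _ _ _))

  dnf-neg : ∀ G → ⟦ dnfTerm (map (map negL) G) ⟧ ≡ inv ⟦ cnfTerm G ⟧
  dnf-neg [] = sym inv-top
  dnf-neg (D ∷ G) = trans (cong₂ join (conj-neg D) (dnf-neg G)) (sym (inv-meet _ _))
    where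
    conj-neg : ∀ D → ⟦ conj (map negL D) ⟧ ≡ inv ⟦ disj D ⟧
    conj-neg [] = sym inv-bot
    conj-neg (l ∷ D) = trans (cong₂ meet (negL-correct l) (conj-neg D)) (sym (inv-join _ _))

  cnf-neg : ∀ F → ⟦ cnfTerm (map (map negL) F) ⟧ ≡ inv ⟦ dnfTerm F ⟧
  cnf-neg [] = sym inv-bot
  cnf-neg (C ∷ F) = trans (cong₂ meet (disj-neg C) (cnf-neg F)) (sym (inv-join _ _))
    where
    disj-neg : ∀ C → ⟦ disj (map negL C) ⟧ ≡ inv ⟦ conj C ⟧
    disj-neg [] = sym inv-top
    disj-neg (l ∷ C) = trans (cong₂ join (negL-correct l) (disj-neg C)) (sym (inv-meet _ _))

  -- likewise for ~, using ~ of a join is the meet of the ~'s and the strong De Morgan law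
  dnf-tilde : ∀ G → ⟦ dnfTerm (map (map tildeL) G) ⟧ ≡ tilde ⟦ cnfTerm G ⟧
  dnf-tilde [] = sym tilde-top
  dnf-tilde (D ∷ G) = trans (cong₂ join (conj-tilde D) (dnf-tilde G)) (sym (tilde-meet _ _))
    where
    conj-tilde : ∀ D → ⟦ conj (map tildeL D) ⟧ ≡ tilde ⟦ disj D ⟧
    conj-tilde [] = sym tilde-bot
    conj-tilde (l ∷ D) = trans (cong₂ meet (tildeL-correct l) (conj-tilde D)) (sym (tilde-join _ _))

  cnf-tilde : ∀ F → ⟦ cnfTerm (map (map tildeL) F) ⟧ ≡ tilde ⟦ dnfTerm F ⟧
  cnf-tilde [] = sym tilde-bot
  cnf-tilde (C ∷ F) = trans (cong₂ meet (disj-tilde C) (cnf-tilde F)) (sym (tilde-join _ _))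
    where
    disj-tilde : ∀ C → ⟦ disj (map tildeL C) ⟧ ≡ tilde ⟦ conj C ⟧
    disj-tilde [] = sym tilde-top
    disj-tilde (l ∷ C) = trans (cong₂ join (tildeL-correct l) (disj-tilde C)) (sym (tilde-meet _ _))

  dnf-correct : ∀ t → ⟦ dnfTerm (dnf t) ⟧ ≡ ⟦ t ⟧
  cnf-correct : ∀ t → ⟦ cnfTerm (cnf t) ⟧ ≡ ⟦ t ⟧
  dnf-correct (var n) = trans (join-bot _) (top-greatest _)
  dnf-correct (s ∧ t) = trans (dnf-cross (dnf s) (dnf t)) (cong₂ meet (dnf-correct s) (dnf-correct t))
  dnf-correct (s ∨ t) = trans (dnf-++ (dnf s) (dnf t)) (cong₂ join (dnf-correct s) (dnf-correct t))
  dnf-correct (s ′) = trans (dnf-neg (cnf s)) (cong inv (cnf-correct s))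
  dnf-correct (s ~) = trans (dnf-tilde (cnf s)) (cong tilde (cnf-correct s))
  dnf-correct 𝟎 = refl
  dnf-correct 𝟏 = join-bot _
  cnf-correct (var n) = trans (top-greatest _) (join-bot _)
  cnf-correct (s ∧ t) = trans (cnf-++ (cnf s) (cnf t)) (cong₂ meet (cnf-correct s) (cnf-correct t))
  cnf-correct (s ∨ t) = trans (cnf-cross (cnf s) (cnf t)) (cong₂ join (cnf-correct s) (cnf-correct t))
  cnf-correct (s ′) = trans (cnf-neg (dnf s)) (cong inv (dnf-correct s))
  cnf-correct (s ~) = trans (cnf-tilde (dnf s)) (cong tilde (dnf-correct s))
  cnf-correct 𝟎 = top-greatest _
  cnf-correct 𝟏 = refl

  clausewise⇒ : ∀ s t → ⟦ s ⟧ ⊑ ⟦ t ⟧ → ∀ {C D} → C ∈ dnf s → D ∈ cnf t → ⟦ conj C ⟧ ⊑ ⟦ disj D ⟧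
  clausewise⇒ s t s⊑t C∈ D∈ = ⊑-trans (conj-below-dnf C∈)
    (⊑-trans (≡⇒⊑ (dnf-correct s)) (⊑-trans s⊑t (⊑-trans (≡⇒⊑ (sym (cnf-correct t))) (cnf-below-disj D∈))))

  clausewise⇐ : ∀ s t → (∀ {C D} → C ∈ dnf s → D ∈ cnf t → ⟦ conj C ⟧ ⊑ ⟦ disj D ⟧) → ⟦ s ⟧ ⊑ ⟦ t ⟧
  clausewise⇐ s t clauses = ⊑-trans (≡⇒⊑ (sym (dnf-correct s)))
    (⊑-trans (dnf-below-cnf (dnf s) (cnf t) clauses) (≡⇒⊑ (cnf-correct t)))

-- 𝐃₅ is finite, so its identities and quasi-identities are decided by enumeration,
-- through a bijection with Fin 5.
toFin : D5 → Fin 5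
toFin d0 = zero
toFin da = suc zero
toFin dd = suc (suc zero)
toFin da' = suc (suc (suc zero))
toFin d1 = suc (suc (suc (suc zero)))

fromFin : Fin 5 → D5
fromFin zero = d0
fromFin (suc zero) = da
fromFin (suc (suc zero)) = dd
fromFin (suc (suc (suc zero))) = da'
fromFin (suc (suc (suc (suc zero)))) = d1

fromFin-toFin : ∀ a → fromFin (toFin a) ≡ a
fromFin-toFin d0 = refl
fromFin-toFin da = refl
fromFin-toFin dd = refl
fromFin-toFin da' = refl
fromFin-toFin d1 = refl

_≟D_ : DecidableEquality D5
a ≟D b = map′ (λ e → trans (sym (fromFin-toFin a)) (trans (cong fromFin e) (fromFin-toFin b)))
              (cong toFin) (toFin a Fin.≟ toFin b)

∀D? : {P : D5 → Set} → (∀ a → Dec (P a)) → Dec (∀ a → P a)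
∀D? {P} P? = map′ (λ h a → subst P (fromFin-toFin a) (h (toFin a))) (λ h i → h (fromFin i))
                  (Fin.all? (λ i → P? (fromFin i)))

open Alg 𝐃₅ using () renaming (meet to _⊓_; join to _⊔_)

D5-isAOL : IsAntiortholattice 𝐃₅
D5-isAOL = record
  { isPBZ* = record
    { isBZ = record
      { isPseudoKleene = record
        { isBIL = record
          { isBoundedLattice = record
            { ∧-assoc = from-yes (∀D? λ a → ∀D? λ b → ∀D? λ c → ((a ⊓ b) ⊓ c) ≟D (a ⊓ (b ⊓ c)))
            ; ∨-assoc = from-yes (∀D? λ a → ∀D? λ b → ∀D? λ c → ((a ⊔ b) ⊔ c) ≟D (a ⊔ (b ⊔ c)))
            ; ∧-comm = from-yes (∀D? λ a → ∀D? λ b → (a ⊓ b) ≟D (b ⊓ a))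
            ; ∨-comm = from-yes (∀D? λ a → ∀D? λ b → (a ⊔ b) ≟D (b ⊔ a))
            ; ∧-absorb = from-yes (∀D? λ a → ∀D? λ b → (a ⊓ (a ⊔ b)) ≟D a)
            ; ∨-absorb = from-yes (∀D? λ a → ∀D? λ b → (a ⊔ (a ⊓ b)) ≟D a)
            ; bot-least = from-yes (∀D? λ a → (d0 ⊓ a) ≟D d0)
            ; top-greatest = from-yes (∀D? λ a → (a ⊓ d1) ≟D a)
            }
          ; involutive = from-yes (∀D? λ a → D5-inv (D5-inv a) ≟D a)
          ; order-reversing = from-yes (∀D? λ a → ∀D? λ b →
              ((a ⊓ b) ≟D a) →-dec ((D5-inv b ⊓ D5-inv a) ≟D D5-inv b))
          }
        ; kleene = from-yes (∀D? λ a → ∀D? λ b →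
            ((a ⊓ D5-inv a) ⊓ (b ⊔ D5-inv b)) ≟D (a ⊓ D5-inv a))
        }
      ; bz1 = from-yes (∀D? λ a → (a ⊓ D5-tilde a) ≟D d0)
      ; bz2 = from-yes (∀D? λ a → (a ⊓ D5-tilde (D5-tilde a)) ≟D a)
      ; bz3 = from-yes (∀D? λ a → ∀D? λ b →
          ((a ⊓ b) ≟D a) →-dec ((D5-tilde b ⊓ D5-tilde a) ≟D D5-tilde b))
      ; bz4 = from-yes (∀D? λ a → D5-inv (D5-tilde a) ≟D D5-tilde (D5-tilde a))
      }
    ; star = from-yes (∀D? λ a → (D5-tilde (a ⊓ D5-inv a) ⊓ (D5-tilde a ⊔ D5-tilde (D5-inv a)))
                                  ≟D D5-tilde (a ⊓ D5-inv a))
    ; pbz = from-yes (∀D? λ a → ∀D? λ b →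
        (((D5-tilde a ⊔ (◇ 𝐃₅ a ⊓ ◇ 𝐃₅ b)) ⊓ ◇ 𝐃₅ a) ⊓ ◇ 𝐃₅ b)
          ≟D ((D5-tilde a ⊔ (◇ 𝐃₅ a ⊓ ◇ 𝐃₅ b)) ⊓ ◇ 𝐃₅ a))
    }
  ; anti = from-yes (∀D? λ a → ((a ⊓ D5-inv a) ≟D d0) →-dec ((a ≟D d0) ⊎-dec (a ≟D d1)))
  }

D5-distrib : 𝐃₅ ⊨ distributivity
D5-distrib ρ = from-yes (∀D? λ a → ∀D? λ b → ∀D? λ c → (a ⊓ (b ⊔ c)) ≟D ((a ⊓ b) ⊔ (a ⊓ c))) (ρ 0) (ρ 1) (ρ 2)

D5-strongDeMorgan : 𝐃₅ ⊨ strongDeMorgan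
D5-strongDeMorgan ρ = from-yes (∀D? λ a → ∀D? λ b → D5-tilde (a ⊓ b) ≟D (D5-tilde a ⊔ D5-tilde b)) (ρ 0) (ρ 1)

D5-inV₃ : InV₃ 𝐃₅
D5-inV₃ = (λ e valid → valid 𝐃₅ D5-isAOL) , D5-distrib , D5-strongDeMorgan

meet-closed : (P : D5 → Set) → ∀ {a b} → P a → P b → P (a ⊓ b)
meet-closed P {a} {b} pa pb with rank a ≤ᵇ rank b
... | true = pa
... | false = pb

join-closed : (P : D5 → Set) → ∀ {a b} → P a → P b → P (a ⊔ b)
join-closed P {a} {b} pa pb with rank a ≤ᵇ rank b
... | true = pb
... | false = pa

rank-mono : ∀ {a b} → _≤A_ 𝐃₅ a b → rank a ≤ rank b
rank-mono {a} {b} a≤b with rank a ≤ᵇ rank b in ≤ᵇ-true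
... | true = ≤ᵇ⇒≤ (rank a) (rank b) (subst T (sym ≤ᵇ-true) tt)
... | false = subst (λ c → rank c ≤ rank b) a≤b ≤-refl

separated : (σ : ℕ → D5) (k : ℕ) (C D : Clause) → k < rank d1
          → (∀ {l} → l ∈ C → k < rank (eval 𝐃₅ σ (litT l)))
          → (∀ {l} → l ∈ D → rank (eval 𝐃₅ σ (litT l)) ≤ k)
          → ¬ (_≤A_ 𝐃₅ (eval 𝐃₅ σ (conj C)) (eval 𝐃₅ σ (disj D)))
separated σ k C D k<4 high low C≤D =
  n≮n k (<-≤-trans (<-≤-trans (conj-high C high) (rank-mono C≤D)) (disj-low D low))
  where
  conj-high : ∀ C → (∀ {l} → l ∈ C → k < rank (eval 𝐃₅ σ (litT l))) → k < rank (eval 𝐃₅ σ (conj C))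
  conj-high [] _ = k<4
  conj-high (l ∷ C) h = meet-closed (λ v → k < rank v) (h (here refl)) (conj-high C (λ l∈C → h (there l∈C)))
  disj-low : ∀ D → (∀ {l} → l ∈ D → rank (eval 𝐃₅ σ (litT l)) ≤ k) → rank (eval 𝐃₅ σ (disj D)) ≤ k
  disj-low [] _ = z≤n
  disj-low (l ∷ D) h = join-closed (λ v → rank v ≤ k) (h (here refl)) (disj-low D (λ l∈D → h (there l∈D)))

data Mid : Set where
  ma md ma' : Mid

⌊_⌋ : Mid → D5
⌊ ma ⌋ = da
⌊ md ⌋ = dd
⌊ ma' ⌋ = da'

flipMid : Mid → Mid
flipMid ma = ma'
flipMid md = md
flipMid ma' = ma

flipMid-invol : ∀ m → flipMid (flipMid m) ≡ m
flipMid-invol ma = refl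
flipMid-invol md = refl
flipMid-invol ma' = refl

flipMid-fixed : ∀ {m} → flipMid m ≡ m → m ≡ md
flipMid-fixed {md} _ = refl

signedMid : Sign → Mid → Mid
signedMid pos m = m
signedMid neg m = flipMid m

signed-⌊⌋ : ∀ s m → signed 𝐃₅ s ⌊ m ⌋ ≡ ⌊ signedMid s m ⌋
signed-⌊⌋ pos m = refl
signed-⌊⌋ neg ma = refl
signed-⌊⌋ neg md = refl
signed-⌊⌋ neg ma' = refl

rank-below-d : ∀ {m} → m ≢ ma' → rank ⌊ m ⌋ ≤ 2
rank-below-d {ma} _ = s≤s z≤n
rank-below-d {md} _ = s≤s (s≤s z≤n)
rank-below-d {ma'} m≢a′ = ⊥-elim (m≢a′ refl)

rank-above-a : ∀ {m} → m ≢ ma → 1 < rank ⌊ m ⌋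
rank-above-a {ma} m≢a = ⊥-elim (m≢a refl)
rank-above-a {md} _ = s≤s (s≤s z≤n)
rank-above-a {ma'} _ = s≤s (s≤s z≤n)

module D5Facts = AOLFacts 𝐃₅ D5-isAOL

middle-class : ∀ m → D5Facts.Class ⌊ m ⌋
middle-class ma = D5Facts.middle refl refl
middle-class md = D5Facts.middle refl refl
middle-class ma' = D5Facts.middle refl refl

middle-shape : ∀ m → D5Facts.shape (middle-class m) ≡ isMiddle
middle-shape ma = refl
middle-shape md = refl
middle-shape ma' = refl

_≟Sign_ : DecidableEquality Sign
pos ≟Sign pos = yes refl
pos ≟Sign neg = no λ ()
neg ≟Sign pos = no λ ()
neg ≟Sign neg = yes refl

_≟Tildes_ : DecidableEquality Tildes
none ≟Tildes none = yes refl
none ≟Tildes once = no λ ()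
none ≟Tildes twice = no λ ()
once ≟Tildes none = no λ ()
once ≟Tildes once = yes refl
once ≟Tildes twice = no λ ()
twice ≟Tildes none = no λ ()
twice ≟Tildes once = no λ ()
twice ≟Tildes twice = yes refl

_≟Lit_ : DecidableEquality Lit
_≟Lit_ = ≡-dec _≟ℕ_ (≡-dec _≟Sign_ _≟Tildes_)

open import Data.List.Membership.DecPropositional _≟Lit_ using (_∈?_)

HasPair NoPair : Clause → Set
HasPair E = ∃[ n ] ((n , pos , none) ∈ E × (n , neg , none) ∈ E)
NoPair E = ∀ n → (n , pos , none) ∈ E → (n , neg , none) ∈ E → ⊥

pair? : ∀ E → HasPair E ⊎ NoPair E
pair? E with any? (λ l → ((proj₁ l , pos , none) ∈? E) ×-dec ((proj₁ l , neg , none) ∈? E)) E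
... | yes found = let ((n , _) , _ , pair) = find found in inj₁ (n , pair)
... | no none-found = inj₂ λ n p q → none-found (lose p (p , q))

-- The middle point given to a middle variable n by the countermodel built from a
-- pair-free clause E: hi if x ∈ E, its flip if x′ ∈ E, and d otherwise.
pickMid : {P Q : Set} → Mid → Dec P → Dec Q → Mid
pickMid hi (yes _) _ = hi
pickMid hi (no _) (yes _) = flipMid hi
pickMid hi (no _) (no _) = md

choose : Clause → Mid → ℕ → Mid
choose E hi n = pickMid hi ((n , pos , none) ∈? E) ((n , neg , none) ∈? E)

choose-hit : ∀ E hi → NoPair E → ∀ {n s} → (n , s , none) ∈ E → signedMid s (choose E hi n) ≡ hi
choose-hit E hi np {n} {pos} x∈E = hit (_ ∈? E) (_ ∈? E) x∈E
  where
  hit : ∀ {P Q} (p? : Dec P) (q? : Dec Q) → P → pickMid hi p? q? ≡ hi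
  hit (yes _) _ _ = refl
  hit (no ¬p) _ p = ⊥-elim (¬p p)
choose-hit E hi np {n} {neg} x′∈E = hit (_ ∈? E) (_ ∈? E) (np n)
  where
  hit : ∀ {P} (p? : Dec P) (q? : Dec ((n , neg , none) ∈ E)) → (P → (n , neg , none) ∈ E → ⊥)
      → flipMid (pickMid hi p? q?) ≡ hi
  hit (yes p) _ excl = ⊥-elim (excl p x′∈E)
  hit (no _) (yes _) _ = flipMid-invol hi
  hit (no _) (no ¬q) _ = ⊥-elim (¬q x′∈E)

choose-miss : ∀ E hi → hi ≢ md → ∀ {n s} → (n , s , none) ∉ E → signedMid s (choose E hi n) ≢ hi
choose-miss E hi hi≢d {n} {pos} x∉E = miss (_ ∈? E) (_ ∈? E)
  where
  miss : ∀ {Q} (p? : Dec ((n , pos , none) ∈ E)) (q? : Dec Q) → pickMid hi p? q? ≢ hi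
  miss (yes x∈E) _ = ⊥-elim (x∉E x∈E)
  miss (no _) (yes _) = hi≢d ∘ flipMid-fixed
  miss (no _) (no _) = hi≢d ∘ sym
choose-miss E hi hi≢d {n} {neg} x′∉E = miss (_ ∈? E) (_ ∈? E)
  where
  miss : ∀ {P} (p? : Dec P) (q? : Dec ((n , neg , none) ∈ E)) → flipMid (pickMid hi p? q?) ≢ hi
  miss (yes _) _ = hi≢d ∘ flipMid-fixed
  miss (no _) (yes x′∈E) = ⊥-elim (x′∉E x′∈E)
  miss (no _) (no _) = hi≢d ∘ sym

isConst? : ∀ b v → Dec (v ≡ constV b)
isConst? b (constV b′) = map′ (cong constV) (λ { refl → refl }) (b′ ≟Bool b)
isConst? b (signedV _) = no λ ()

module ClauseLemma (B : Alg) (aol : IsAntiortholattice B) (ρ : ℕ → Alg.Carrier B)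
                   (C D : Clause) (valid : 𝐃₅ ⊨ (conj C ∧ disj D , conj C)) where
  open Alg B
  open AOLFacts B aol
  open ClauseOrder B isBoundedLattice ρ

  class : ∀ n → Class (ρ n)
  class n = classify (ρ n)

  val : Lit → Val
  val (n , s , t) = litVal (shape (class n)) s t

  value : ∀ l → ⟦ litT l ⟧ ≡ interp B (ρ (proj₁ l)) (val l)
  value (n , s , t) = trans (evalLit B ρ n s t) (literal-value (class n) s t)

  -- Valuations of 𝐃₅ of the same shape as ρ: constants are kept, and each middle
  -- variable n goes to a middle point mid n.
  lift : ∀ {a} → Mid → Class a → D5
  lift m (constant b _) = const 𝐃₅ b
  lift m (middle _ _) = ⌊ m ⌋

  lift-class : ∀ {a} m (c : Class a) → D5Facts.Class (lift m c)
  lift-class m (constant b _) = D5Facts.constant b refl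
  lift-class m (middle _ _) = middle-class m

  lift-shape : ∀ {a} m (c : Class a) → D5Facts.shape (lift-class m c) ≡ shape c
  lift-shape m (constant b _) = refl
  lift-shape m (middle _ _) = middle-shape m

  lift-middle : ∀ {a} m (c : Class a) → shape c ≡ isMiddle → lift m c ≡ ⌊ m ⌋
  lift-middle m (middle _ _) _ = refl

  σ : (ℕ → Mid) → ℕ → D5
  σ mid n = lift (mid n) (class n)

  signed-middle : ∀ (mid : ℕ → Mid) n → shape (class n) ≡ isMiddle
                → ∀ s → signed 𝐃₅ s (σ mid n) ≡ ⌊ signedMid s (mid n) ⌋
  signed-middle mid n isMid s =
    trans (cong (signed 𝐃₅ s) (lift-middle (mid n) (class n) isMid)) (signed-⌊⌋ s (mid n))

  -- so each literal takes under σ the value it takes under ρ, read in 𝐃₅: either the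
  -- same constant, or (untilded, on a middle variable) the signed middle point
  literal-cases : ∀ (mid : ℕ → Mid) n s t (P : D5 → Set)
                → (∀ b → val (n , s , t) ≡ constV b → P (const 𝐃₅ b))
                → (t ≡ none → P ⌊ signedMid s (mid n) ⌋)
                → P (eval 𝐃₅ (σ mid) (litT (n , s , t)))
  literal-cases mid n s t P const-case middle-case =
    subst P (sym σ-value) (by-val (val (n , s , t)) refl)
    where
    σ-value : eval 𝐃₅ (σ mid) (litT (n , s , t)) ≡ interp 𝐃₅ (σ mid n) (val (n , s , t))
    σ-value = trans (evalLit 𝐃₅ (σ mid) n s t)
      (trans (D5Facts.literal-value (lift-class (mid n) (class n)) s t)
             (cong (λ sh → interp 𝐃₅ (σ mid n) (litVal sh s t)) (lift-shape (mid n) (class n))))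
    by-val : ∀ v → val (n , s , t) ≡ v → P (interp 𝐃₅ (σ mid n) v)
    by-val (constV b) v≡b = const-case b v≡b
    by-val (signedV s′) v≡x =
      let (isMid , t≡none , s≡s′) = litVal-signed v≡x in
      subst (λ s″ → P (signed 𝐃₅ s″ (σ mid n))) s≡s′
            (subst P (sym (signed-middle mid n isMid s)) (middle-case t≡none))

  from-zero : Any (λ l → val l ≡ constV false) C → ⟦ conj C ⟧ ⊑ ⟦ disj D ⟧
  from-zero zero∈C = let (l , l∈C , l≡0) = find zero∈C in
    ⊑-trans (conj-lower l∈C) (⊑-trans (≡⇒⊑ (trans (value l) (cong (interp B _) l≡0))) (bot-least _))

  from-one : Any (λ l → val l ≡ constV true) D → ⟦ conj C ⟧ ⊑ ⟦ disj D ⟧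
  from-one one∈D = let (l , l∈D , l≡1) = find one∈D in
    ⊑-trans (top-greatest _) (⊑-trans (≡⇒⊑ (sym (trans (value l) (cong (interp B _) l≡1)))) (disj-upper l∈D))

  from-shared : Any (_∈ D) C → ⟦ conj C ⟧ ⊑ ⟦ disj D ⟧
  from-shared shared = let (l , l∈C , l∈D) = find shared in ⊑-trans (conj-lower l∈C) (disj-upper l∈D)

  from-pairs : HasPair C → HasPair D → ⟦ conj C ⟧ ⊑ ⟦ disj D ⟧
  from-pairs (n , x∈C , x′∈C) (m , y∈D , y′∈D) = ⊑-trans (glb (conj-lower x∈C) (conj-lower x′∈C))
    (⊑-trans (kleene (ρ n) (ρ m)) (lub (disj-upper y∈D) (disj-upper y′∈D)))

  -- Otherwise, if C has no pair, sending the middle x ∈ C to a′, x′ ∈ C to a and the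
  -- remaining middle variables to d puts C above d and D at most at d.
  meet-pair-free : NoPair C → (∀ {l} → l ∈ C → val l ≢ constV false)
                 → (∀ {l} → l ∈ D → val l ≢ constV true) → (∀ {l} → l ∈ C → l ∉ D) → ⊥
  meet-pair-free noPair C≢0 D≢1 disjoint =
    separated (σ mid) 2 C D (s≤s (s≤s (s≤s z≤n))) high low (valid (σ mid))
    where
    mid : ℕ → Mid
    mid = choose C ma'
    high : ∀ {l} → l ∈ C → 2 < rank (eval 𝐃₅ (σ mid) (litT l))
    high {n , s , t} l∈C = literal-cases mid n s t (λ v → 2 < rank v)
      (λ { true _ → s≤s (s≤s (s≤s z≤n)) ; false l≡0 → ⊥-elim (C≢0 l∈C l≡0) })
      (λ t≡none → subst (λ m → 2 < rank ⌊ m ⌋)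
        (sym (choose-hit C ma' noPair (subst (λ t → (n , s , t) ∈ C) t≡none l∈C))) ≤-refl)
    low : ∀ {l} → l ∈ D → rank (eval 𝐃₅ (σ mid) (litT l)) ≤ 2
    low {n , s , t} l∈D = literal-cases mid n s t (λ v → rank v ≤ 2)
      (λ { false _ → z≤n ; true l≡1 → ⊥-elim (D≢1 l∈D l≡1) })
      (λ t≡none → rank-below-d (choose-miss C ma' (λ ())
        (λ x∈C → disjoint x∈C (subst (λ t → (n , s , t) ∈ D) t≡none l∈D))))

  -- and dually, if D has no pair, sending x ∈ D to a, x′ ∈ D to a′ and the rest to d
  -- puts D at most at a and C above a.
  join-pair-free : NoPair D → (∀ {l} → l ∈ C → val l ≢ constV false)
                 → (∀ {l} → l ∈ D → val l ≢ constV true) → (∀ {l} → l ∈ C → l ∉ D) → ⊥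
  join-pair-free noPair C≢0 D≢1 disjoint =
    separated (σ mid) 1 C D (s≤s (s≤s z≤n)) high low (valid (σ mid))
    where
    mid : ℕ → Mid
    mid = choose D ma
    high : ∀ {l} → l ∈ C → 1 < rank (eval 𝐃₅ (σ mid) (litT l))
    high {n , s , t} l∈C = literal-cases mid n s t (λ v → 1 < rank v)
      (λ { true _ → s≤s (s≤s z≤n) ; false l≡0 → ⊥-elim (C≢0 l∈C l≡0) })
      (λ t≡none → rank-above-a (choose-miss D ma (λ ())
        (disjoint (subst (λ t → (n , s , t) ∈ C) t≡none l∈C))))
    low : ∀ {l} → l ∈ D → rank (eval 𝐃₅ (σ mid) (litT l)) ≤ 1
    low {n , s , t} l∈D = literal-cases mid n s t (λ v → rank v ≤ 1)
      (λ { false _ → z≤n ; true l≡1 → ⊥-elim (D≢1 l∈D l≡1) })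
      (λ t≡none → subst (λ m → rank ⌊ m ⌋ ≤ 1)
        (sym (choose-hit D ma noPair (subst (λ t → (n , s , t) ∈ D) t≡none l∈D))) ≤-refl)

  without-easy-reason : (∀ {l} → l ∈ C → val l ≢ constV false) → (∀ {l} → l ∈ D → val l ≢ constV true)
                      → (∀ {l} → l ∈ C → l ∉ D) → ⟦ conj C ⟧ ⊑ ⟦ disj D ⟧
  without-easy-reason C≢0 D≢1 disjoint with pair? C | pair? D
  ... | inj₁ pairC | inj₁ pairD = from-pairs pairC pairD
  ... | inj₂ noPairC | _ = ⊥-elim (meet-pair-free noPairC C≢0 D≢1 disjoint)
  ... | inj₁ _ | inj₂ noPairD = ⊥-elim (join-pair-free noPairD C≢0 D≢1 disjoint)

  conj≤disj : ⟦ conj C ⟧ ⊑ ⟦ disj D ⟧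
  conj≤disj with any? (λ l → isConst? false (val l)) C | any? (λ l → isConst? true (val l)) D
               | any? (_∈? D) C
  ... | yes zero∈C | _ | _ = from-zero zero∈C
  ... | no _ | yes one∈D | _ = from-one one∈D
  ... | no _ | no _ | yes shared = from-shared shared
  ... | no no-zero | no no-one | no unshared = without-easy-reason
    (λ l∈C l≡0 → no-zero (lose l∈C l≡0)) (λ l∈D l≡1 → no-one (lose l∈D l≡1))
    (λ l∈C l∈D → unshared (lose l∈C l∈D))

clause-lemma : ∀ C D → 𝐃₅ ⊨ (conj C ∧ disj D , conj C) → EqAOL (conj C ∧ disj D , conj C)
clause-lemma C D valid B aol ρ = ClauseLemma.conj≤disj B aol ρ C D valid

-- Every inequality valid in 𝐃₅ holds in every member A of 𝕍₃: it holds clause-wise in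
-- 𝐃₅, hence clause-wise in every antiortholattice, hence clause-wise in A.
inequality-transfer : (A : Alg) → InV₃ A → ∀ s t
                    → (∀ σ → _≤A_ 𝐃₅ (eval 𝐃₅ σ s) (eval 𝐃₅ σ t))
                    → ∀ ρ → _≤A_ A (eval A ρ s) (eval A ρ t)
inequality-transfer A inV₃ s t s≤t-in-D5 ρ = NormalForms.clausewise⇐ A (normalFormLaws A inV₃) ρ s t
  λ {C} {D} C∈dnf D∈cnf → proj₁ inV₃ (conj C ∧ disj D , conj C)
    (clause-lemma C D λ σ → NormalForms.clausewise⇒ 𝐃₅ (normalFormLaws 𝐃₅ D5-inV₃) σ s t
      (s≤t-in-D5 σ) C∈dnf D∈cnf) ρ

V₃⊆V[D₅] : (A : Alg) → InV₃ A → InVD5 A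
V₃⊆V[D₅] A inV₃ (s , t) s≈t-in-D5 ρ = ⊑-antisym
  (inequality-transfer A inV₃ s t (λ σ → D5Facts.≡⇒⊑ (s≈t-in-D5 σ)) ρ)
  (inequality-transfer A inV₃ t s (λ σ → D5Facts.≡⇒⊑ (sym (s≈t-in-D5 σ))) ρ)
  where open LatticeOrder A (NormalFormLaws.lattice (normalFormLaws A inV₃)) using (⊑-antisym)

-- 𝐃₅ itself lies in 𝕍₃, so every identity of V(𝐃₅) is an identity of 𝕍₃.
V[D₅]⊆V₃ : (A : Alg) → InVD5 A → InV₃ A
V[D₅]⊆V₃ A inVD5 = (λ e e-in-AOL → inVD5 e (e-in-AOL 𝐃₅ D5-isAOL))
                 , inVD5 distributivity D5-distrib
                 , inVD5 strongDeMorgan D5-strongDeMorgan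

mainTheorem11 : (A : Alg) → InV₃ A ⇔ InVD5 A
mainTheorem11 A = mk⇔ (V₃⊆V[D₅] A) (V[D₅]⊆V₃ A)
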